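{- Let $h$ and $g$ be order functions taking only values that are powers of two, and suppose the pair $(h,g)$ allows splitting. Let $m=\mathcal{M}(h,g)$. Then the pairs $(m,g)$ and $(h,m)$ both allow splitting.
   Context: An order function is a computable, nondecreasing, unbounded function $\omega\to\omega$. For an order function $g$ and $l\in\omega$, let $w(g,l)=\prod_{i<l}g(i)$ and $r(g,l)=2^{3+3w(g,l)}$. If $h(n)=2^{h'(n)}$ and $g(n)=2^{g'(n)}$ are order functions with $h',g':\omega\to\omega$, the middle of $h$ and $g$ is the function $\mathcal{M}(h,g)(n)=2^{\lfloor (h'(n)+g'(n))/2\rfloor}$. For order functions $h,g$ and $N\in\omega$, the pair $(h,g)$ allows splitting above $N$ if (1) $h(N)\ge g(N)$; (2) for $n\ge N$, $h(n)/g(n)$ is nondecreasing in $n$; and (3) there is an increasing sequence $(l_i)_{i\in\omega}$ of natural numbers with $l_0\ge N$ such that $h(l_i)/g(l_i)\ge (r(h,l_i))^i$ for all $i$. The pair $(h,g)$ allows splitting if it allows splitting above some $N\in\omega$. -}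

module Defs where

open import Data.Nat using (ℕ; zero; suc; _+_; _*_; _^_; _≤_; _<_; _≥_; ⌊_/2⌋)
open import Data.Product using (Σ; ∃; _×_; _,_)

-- An order function: nondecreasing and unbounded ℕ → ℕ
-- (computability is automatic for Agda functions).
IsOrder : (ℕ → ℕ) → Set
IsOrder f = (∀ n m → n ≤ m → f n ≤ f m) × (∀ k → ∃ λ n → k ≤ f n)

pow2 : (ℕ → ℕ) → ℕ → ℕ
pow2 e n = 2 ^ e n

w : (ℕ → ℕ) → ℕ → ℕ
w g zero    = 1
w g (suc l) = w g l * g l

r : (ℕ → ℕ) → ℕ → ℕ
r g l = 2 ^ (3 + 3 * w g l)

-- middle of h = 2^h' and g = 2^g' : n ↦ 2^⌊(h'(n)+g'(n))/2⌋
middle : (ℕ → ℕ) → (ℕ → ℕ) → ℕ → ℕ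
middle h' g' n = 2 ^ ⌊ h' n + g' n /2⌋

-- (h,g) allows splitting above N. Ratios h(n)/g(n) are compared by
-- cross-multiplication (g takes positive values in all uses here).
AllowsSplittingAbove : (ℕ → ℕ) → (ℕ → ℕ) → ℕ → Set
AllowsSplittingAbove h g N =
  (h N ≥ g N)
  × (∀ n m → N ≤ n → n ≤ m → h n * g m ≤ h m * g n)
  × (Σ (ℕ → ℕ) λ l →
       (∀ i → l i < l (suc i))
       × (N ≤ l 0)
       × (∀ i → h (l i) ≥ (r h (l i)) ^ i * g (l i)))

AllowsSplitting : (ℕ → ℕ) → (ℕ → ℕ) → Set
AllowsSplitting h g = ∃ λ N → AllowsSplittingAbove h g N

-- Writing h = 2^H and g = 2^G, every condition of "allows splitting" becomes a
-- linear condition on exponents: the gap H − G is nondecreasing above N and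
-- H (l i) ≥ log₂ r(h, l i) · i + G (l i).  The middle has exponent
-- F = ⌊(H + G)/2⌋, so both gaps H − F and F − G are about half of H − G and
-- inherit its monotonicity.  Along l they are only half as large while the
-- required bound log₂ r grows, but above N we have F ≤ H, hence
-- w(m, L) ≤ w(m, N) · w(h, L); passing to the subsequence l (i · 2K) with
-- K = w(m, N) restores the required gaps.
module Submission where

open import Defs
open import Data.Nat
open import Data.Nat.Properties
open import Data.Nat.Tactic.RingSolver using (solve-∀)
open import Data.Product using (Σ; _×_; _,_)
open import Function.Bundles using (_⇔_; mk⇔; Equivalence)
open import Relation.Binary.PropositionalEquality
open import Relation.Nullary using (yes; no; contradiction)

open Equivalence using (to; from)

2^-cancel-≤ : ∀ m n → 2 ^ m ≤ 2 ^ n → m ≤ n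
2^-cancel-≤ m n 2^m≤2^n with m ≤? n
... | yes m≤n = m≤n
... | no m≰n  = contradiction 2^m≤2^n (<⇒≱ (^-monoʳ-< 2 (s≤s (s≤s z≤n)) (≰⇒> m≰n)))

2^-≤⇔ : ∀ {m n} → 2 ^ m ≤ 2 ^ n ⇔ m ≤ n
2^-≤⇔ = mk⇔ (2^-cancel-≤ _ _) (^-monoʳ-≤ 2)

2^*2^-≤⇔ : ∀ a b c d → 2 ^ a * 2 ^ b ≤ 2 ^ c * 2 ^ d ⇔ a + b ≤ c + d
2^*2^-≤⇔ a b c d
  rewrite sym (^-distribˡ-+-* 2 a b) | sym (^-distribˡ-+-* 2 c d) = 2^-≤⇔

[2^e]^i*2^b-≤⇔ : ∀ e i b a → (2 ^ e) ^ i * 2 ^ b ≤ 2 ^ a ⇔ e * i + b ≤ a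
[2^e]^i*2^b-≤⇔ e i b a
  rewrite ^-*-assoc 2 e i | sym (^-distribˡ-+-* 2 (e * i) b) = 2^-≤⇔

⌊[n+n]+m/2⌋≡n+⌊m/2⌋ : ∀ n m → ⌊ (n + n) + m /2⌋ ≡ n + ⌊ m /2⌋
⌊[n+n]+m/2⌋≡n+⌊m/2⌋ zero    m = refl
⌊[n+n]+m/2⌋≡n+⌊m/2⌋ (suc n) m rewrite +-suc n n = cong suc (⌊[n+n]+m/2⌋≡n+⌊m/2⌋ n m)

+-⌊/2⌋-mono-≤ : ∀ x y u v → (x + x) + y ≤ (u + u) + v → x + ⌊ y /2⌋ ≤ u + ⌊ v /2⌋
+-⌊/2⌋-mono-≤ x y u v le =
  subst₂ _≤_ (⌊[n+n]+m/2⌋≡n+⌊m/2⌋ x y) (⌊[n+n]+m/2⌋≡n+⌊m/2⌋ u v) (⌊n/2⌋-mono le)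

+-cancel-cross-≤ : ∀ {a b c d} → b ≤ a → a + d ≤ c + b → d ≤ c
+-cancel-cross-≤ {a} {b} {c} {d} b≤a le =
  +-cancelˡ-≤ a d c (≤-trans le (≤-trans (+-monoʳ-≤ c b≤a) (≤-reflexive (+-comm c a))))

⌊+/2⌋-lowerGap : ∀ {k a b} → (k + k) + b ≤ a → k + b ≤ ⌊ a + b /2⌋
⌊+/2⌋-lowerGap {k} {a} {b} le = begin
  k + b                   ≡⟨ n≡⌊n+n/2⌋ (k + b) ⟩
  ⌊ (k + b) + (k + b) /2⌋ ≡⟨ cong ⌊_/2⌋ (shuffle k b) ⟩
  ⌊ ((k + k) + b) + b /2⌋ ≤⟨ ⌊n/2⌋-mono (+-monoˡ-≤ b le) ⟩
  ⌊ a + b /2⌋             ∎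
  where
  open ≤-Reasoning
  shuffle : ∀ k b → (k + b) + (k + b) ≡ ((k + k) + b) + b
  shuffle = solve-∀

⌊+/2⌋-upperGap : ∀ {k a b} → (k + k) + b ≤ a → k + ⌊ a + b /2⌋ ≤ a
⌊+/2⌋-upperGap {k} {a} {b} le = begin
  k + ⌊ a + b /2⌋         ≡⟨ sym (⌊[n+n]+m/2⌋≡n+⌊m/2⌋ k (a + b)) ⟩
  ⌊ (k + k) + (a + b) /2⌋ ≡⟨ cong ⌊_/2⌋ (shuffle k a b) ⟩
  ⌊ ((k + k) + b) + a /2⌋ ≤⟨ ⌊n/2⌋-mono (+-monoˡ-≤ a le) ⟩
  ⌊ a + a /2⌋             ≡⟨ sym (n≡⌊n+n/2⌋ a) ⟩
  a                       ∎
  where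
  open ≤-Reasoning
  shuffle : ∀ k a b → (k + k) + (a + b) ≡ ((k + k) + b) + a
  shuffle = solve-∀

⌊+/2⌋-crossˡ : ∀ a b c d → a + d ≤ c + b → ⌊ a + b /2⌋ + d ≤ ⌊ c + d /2⌋ + b
⌊+/2⌋-crossˡ a b c d le =
  subst₂ _≤_ (+-comm d _) (+-comm b _)
    (+-⌊/2⌋-mono-≤ d (a + b) b (c + d)
      (subst₂ _≤_ (shuffleˡ a b d) (shuffleʳ b c d) (+-monoˡ-≤ (b + d) le)))
  where
  shuffleˡ : ∀ a b d → (a + d) + (b + d) ≡ (d + d) + (a + b)
  shuffleˡ = solve-∀
  shuffleʳ : ∀ b c d → (c + b) + (b + d) ≡ (b + b) + (c + d)
  shuffleʳ = solve-∀

⌊+/2⌋-crossʳ : ∀ a b c d → a + d ≤ c + b → a + ⌊ c + d /2⌋ ≤ c + ⌊ a + b /2⌋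
⌊+/2⌋-crossʳ a b c d le =
  +-⌊/2⌋-mono-≤ a (c + d) c (a + b)
    (subst₂ _≤_ (shuffleˡ a c d) (shuffleʳ a b c) (+-monoˡ-≤ (a + c) le))
  where
  shuffleˡ : ∀ a c d → (a + d) + (a + c) ≡ (a + a) + (c + d)
  shuffleˡ = solve-∀
  shuffleʳ : ∀ a b c → (c + b) + (a + c) ≡ (c + c) + (a + b)
  shuffleʳ = solve-∀

Increasing : (ℕ → ℕ) → Set
Increasing l = ∀ i → l i < l (suc i)

increasing⇒mono-≤ : ∀ {l} → Increasing l → ∀ {i j} → i ≤ j → l i ≤ l j
increasing⇒mono-≤ {l} inc i≤j = go (≤⇒≤′ i≤j)
  where
  go : ∀ {i j} → i ≤′ j → l i ≤ l j
  go ≤′-refl      = ≤-refl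
  go (≤′-step i≤j) = ≤-trans (go i≤j) (<⇒≤ (inc _))

increasing-stride : ∀ {l} → Increasing l → ∀ c → 0 < c → Increasing (λ i → l (i * c))
increasing-stride {l} inc c c>0 i =
  <-≤-trans (inc (i * c)) (increasing⇒mono-≤ inc (m<n+m (i * c) c>0))

w-pow2-positive : ∀ e l → 0 < w (pow2 e) l
w-pow2-positive e zero    = z<s
w-pow2-positive e (suc l) = *-mono-≤ (w-pow2-positive e l) (m^n>0 2 (e l))

w-≤-tail : ∀ (f h : ℕ → ℕ) {N L} → (∀ n → N ≤ n → f n ≤ h n) → N ≤ L →
           w f L * w h N ≤ w h L * w f N
w-≤-tail f h {N} f≤h N≤L = go (≤⇒≤′ N≤L)
  where
  open ≤-Reasoning
  swap : ∀ x y z → x * y * z ≡ x * z * y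
  swap = solve-∀
  go : ∀ {L} → N ≤′ L → w f L * w h N ≤ w h L * w f N
  go ≤′-refl = ≤-reflexive (*-comm (w f N) (w h N))
  go (≤′-step {L} N≤L) = begin
    w f L * f L * w h N   ≡⟨ swap (w f L) (f L) (w h N) ⟩
    w f L * w h N * f L   ≤⟨ *-mono-≤ (go N≤L) (f≤h L (≤′⇒≤ N≤L)) ⟩
    w h L * w f N * h L   ≡⟨ swap (w h L) (w f N) (h L) ⟩
    w h L * h L * w f N   ∎

-- log₂ r(2^H, l), so that r (pow2 H) l ≡ 2 ^ log₂r H l definitionally.
log₂r : (ℕ → ℕ) → ℕ → ℕ
log₂r H l = 3 + 3 * w (pow2 H) l

-- middle H G ≡ pow2 (middle′ H G) definitionally.
middle′ : (ℕ → ℕ) → (ℕ → ℕ) → ℕ → ℕ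
middle′ H G n = ⌊ H n + G n /2⌋

record SplittingExponentsAbove (H G : ℕ → ℕ) (N : ℕ) : Set where
  field
    base           : G N ≤ H N
    cross          : ∀ n m → N ≤ n → n ≤ m → H n + G m ≤ H m + G n
    points         : ℕ → ℕ
    points-inc     : Increasing points
    points-above   : N ≤ points 0
    points-gap     : ∀ i → log₂r H (points i) * i + G (points i) ≤ H (points i)

splitting⇔exponents : ∀ {H G N} →
  AllowsSplittingAbove (pow2 H) (pow2 G) N ⇔ SplittingExponentsAbove H G N
splitting⇔exponents {H} {G} {N} = mk⇔ toExponents fromExponents
  where
  toExponents : AllowsSplittingAbove (pow2 H) (pow2 G) N → SplittingExponentsAbove H G N
  toExponents (base , cross , l , l-inc , l-above , l-gap) = record
    { base         = 2^-cancel-≤ (G N) (H N) base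
    ; cross        = λ n m N≤n n≤m → to (2^*2^-≤⇔ (H n) (G m) (H m) (G n)) (cross n m N≤n n≤m)
    ; points       = l
    ; points-inc   = l-inc
    ; points-above = l-above
    ; points-gap   = λ i → to ([2^e]^i*2^b-≤⇔ (log₂r H (l i)) i (G (l i)) (H (l i))) (l-gap i)
    }
  fromExponents : SplittingExponentsAbove H G N → AllowsSplittingAbove (pow2 H) (pow2 G) N
  fromExponents s =
    ^-monoʳ-≤ 2 base ,
    (λ n m N≤n n≤m → from (2^*2^-≤⇔ (H n) (G m) (H m) (G n)) (cross n m N≤n n≤m)) ,
    points , points-inc , points-above ,
    (λ i → from ([2^e]^i*2^b-≤⇔ (log₂r H (points i)) i (G (points i)) (H (points i))) (points-gap i))
    where open SplittingExponentsAbove s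

module _ {H G : ℕ → ℕ} {N : ℕ} (split : SplittingExponentsAbove H G N) where

  open SplittingExponentsAbove split

  private
    F : ℕ → ℕ
    F = middle′ H G

  G≤H : ∀ n → N ≤ n → G n ≤ H n
  G≤H n N≤n = +-cancel-cross-≤ base (cross N n ≤-refl N≤n)

  G≤middle′ : ∀ n → N ≤ n → G n ≤ F n
  G≤middle′ n N≤n = ⌊+/2⌋-lowerGap {0} (G≤H n N≤n)

  middle′≤H : ∀ n → N ≤ n → F n ≤ H n
  middle′≤H n N≤n = ⌊+/2⌋-upperGap {0} (G≤H n N≤n)

  middle-isOrder : IsOrder (pow2 H) → IsOrder (pow2 G) → IsOrder (middle H G)
  middle-isOrder (h-mono , _) (g-mono , g-unbounded) = mono , unbounded
    where
    mono : ∀ n m → n ≤ m → middle H G n ≤ middle H G m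
    mono n m n≤m = ^-monoʳ-≤ 2 (⌊n/2⌋-mono
      (+-mono-≤ (2^-cancel-≤ (H n) (H m) (h-mono n m n≤m))
                (2^-cancel-≤ (G n) (G m) (g-mono n m n≤m))))
    unbounded : ∀ k → Σ ℕ (λ n → k ≤ middle H G n)
    unbounded k with g-unbounded k
    ... | n , k≤g = N ⊔ n ,
      ≤-trans k≤g (≤-trans (g-mono n (N ⊔ n) (m≤n⊔m N n))
                            (^-monoʳ-≤ 2 (G≤middle′ (N ⊔ n) (m≤m⊔n N n))))

  private
    K : ℕ
    K = w (pow2 F) N

    K>0 : 0 < K
    K>0 = w-pow2-positive F N

    instance
      K≢0 : NonZero K
      K≢0 = >-nonZero K>0

  w-middle-bound : ∀ L → N ≤ L → w (pow2 F) L ≤ w (pow2 H) L * K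
  w-middle-bound L N≤L =
    ≤-trans (m≤m*n (w (pow2 F) L) (w (pow2 H) N) {{>-nonZero (w-pow2-positive H N)}})
            (w-≤-tail (pow2 F) (pow2 H) (λ n N≤n → ^-monoʳ-≤ 2 (middle′≤H n N≤n)) N≤L)

  log₂r-middle-bound : ∀ L → N ≤ L → log₂r F L ≤ log₂r H L * K
  log₂r-middle-bound L N≤L = begin
    3 + 3 * w (pow2 F) L          ≤⟨ +-mono-≤ (m≤m*n 3 K) (*-monoʳ-≤ 3 (w-middle-bound L N≤L)) ⟩
    3 * K + 3 * (w (pow2 H) L * K) ≡⟨ distrib (w (pow2 H) L) K ⟩
    (3 + 3 * w (pow2 H) L) * K    ∎
    where
    open ≤-Reasoning
    distrib : ∀ x K → 3 * K + 3 * (x * K) ≡ (3 + 3 * x) * K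
    distrib = solve-∀

  -- With stride 2K the gap at index i is at least twice log₂r H · K · i, which
  -- dominates both log₂r H · i and log₂r F · i, so half of it suffices.
  sparsePoints : ℕ → ℕ
  sparsePoints i = points (i * (K + K))

  sparsePoints-inc : Increasing sparsePoints
  sparsePoints-inc = increasing-stride points-inc (K + K) (≤-trans K>0 (m≤m+n K K))

  sparsePoints-above : ∀ i → N ≤ sparsePoints i
  sparsePoints-above i = ≤-trans points-above (increasing⇒mono-≤ points-inc z≤n)

  sparsePoints-gap : ∀ i → let L = sparsePoints i; k = log₂r H L * K * i in
                     (k + k) + G L ≤ H L
  sparsePoints-gap i =
    subst (λ x → x + G L ≤ H L) (double (log₂r H L) K i) (points-gap (i * (K + K)))
    where
    L = sparsePoints i
    double : ∀ e K i → e * (i * (K + K)) ≡ e * K * i + e * K * i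
    double = solve-∀

  middle-splits-below : SplittingExponentsAbove F G N
  middle-splits-below = record
    { base         = G≤middle′ N ≤-refl
    ; cross        = λ n m N≤n n≤m → ⌊+/2⌋-crossˡ (H n) (G n) (H m) (G m) (cross n m N≤n n≤m)
    ; points       = sparsePoints
    ; points-inc   = sparsePoints-inc
    ; points-above = sparsePoints-above 0
    ; points-gap   = λ i → let L = sparsePoints i in
        ≤-trans (+-monoˡ-≤ (G L) (*-monoˡ-≤ i (log₂r-middle-bound L (sparsePoints-above i))))
                (⌊+/2⌋-lowerGap (sparsePoints-gap i))
    }

  middle-splits-above : SplittingExponentsAbove H F N
  middle-splits-above = record
    { base         = middle′≤H N ≤-refl
    ; cross        = λ n m N≤n n≤m → ⌊+/2⌋-crossʳ (H n) (G n) (H m) (G m) (cross n m N≤n n≤m)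
    ; points       = sparsePoints
    ; points-inc   = sparsePoints-inc
    ; points-above = sparsePoints-above 0
    ; points-gap   = λ i → let L = sparsePoints i in
        ≤-trans (+-monoˡ-≤ (F L) (*-monoˡ-≤ i (m≤m*n (log₂r H L) K)))
                (⌊+/2⌋-upperGap (sparsePoints-gap i))
    }

lemma5p5 : (h' g' : ℕ → ℕ) →
    IsOrder (pow2 h') → IsOrder (pow2 g') →
    AllowsSplitting (pow2 h') (pow2 g') →
    (IsOrder (middle h' g')
    × AllowsSplitting (middle h' g') (pow2 g')
    × AllowsSplitting (pow2 h') (middle h' g'))
lemma5p5 h' g' h-order g-order (N , split) =
  middle-isOrder exponents h-order g-order ,
  (N , from splitting⇔exponents (middle-splits-below exponents)) ,
  (N , from splitting⇔exponents (middle-splits-above exponents))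
  where
  exponents : SplittingExponentsAbove h' g' N
  exponents = to splitting⇔exponents split
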